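{- Let $(v,w)\in S_n\times S_n$ be well-aligned. Then for every critical value $i\in C(v)$ we have $w^{ -1}(i)<w^{ -1}(i+1)$.
   Context: Permutations are written in one-line notation. For $w\in S_n$, $\delta(w)\in S_{n-1}$ is obtained by deleting the entry $1$ from the one-line notation of $w$ and decrementing the remaining entries by $1$. A pair $(v,w)\in S_n\times S_n$ is aligned if (1) $v^{ -1}(1)\le w^{ -1}(1)$ and (2) every index $i$ with $v^{ -1}(1)\le i\le w^{ -1}(1)-1$ satisfies $v(i)<v(i+1)$; it is well-aligned if it is aligned and $(\delta(v),\delta(w))$ is well-aligned (recursively; the pair in $S_1\times S_1$ is well-aligned). For $v\in S_n$, an index $1\le i\le n-1$ is critical if the one-line notation of $v$ contains a subsequence $i,\,j,\,i+1$ (in this order of positions) with $j>i+1$; $C(v)$ denotes the set of critical values of $v$. -}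

module Defs where

open import Data.Nat using (ℕ; zero; suc; pred; _≤_; _<_; _∸_; _+_; _≡ᵇ_)
open import Data.Bool using (if_then_else_)
open import Data.List using (List; []; _∷_; map; upTo)
open import Data.List.Relation.Binary.Permutation.Propositional using (_↭_)
open import Data.Product using (_×_; ∃-syntax)
open import Data.Unit using (⊤)
open import Relation.Binary.PropositionalEquality using (_≡_)

-- Permutations of S_n in one-line notation: a list of length n
-- that is a rearrangement of [1, 2, ..., n].
IsPerm : ℕ → List ℕ → Set
IsPerm n l = l ↭ map suc (upTo n)

-- v(i) : 1-indexed lookup (0 outside the range 1..length).
at : List ℕ → ℕ → ℕ
at []       _             = 0
at (x ∷ xs) zero          = 0
at (x ∷ xs) (suc zero)    = x
at (x ∷ xs) (suc (suc i)) = at xs (suc i)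

-- v⁻¹(x) : 1-indexed position of (the first occurrence of) x.
indexOf : ℕ → List ℕ → ℕ
indexOf x []       = 0
indexOf x (y ∷ ys) = if x ≡ᵇ y then 1 else suc (indexOf x ys)

δ : List ℕ → List ℕ
δ []                  = []
δ (zero ∷ xs)         = zero ∷ δ xs   -- never occurs for permutations
δ (suc zero ∷ xs)     = δ xs
δ (suc (suc x) ∷ xs)  = suc x ∷ δ xs

Aligned : List ℕ → List ℕ → Set
Aligned v w =
  indexOf 1 v ≤ indexOf 1 w ×
  (∀ i → indexOf 1 v ≤ i → i ≤ indexOf 1 w ∸ 1 → at v i < at v (suc i))

WellAligned : ℕ → List ℕ → List ℕ → Set
WellAligned zero          v w = ⊤
WellAligned (suc zero)    v w = ⊤
WellAligned (suc (suc n)) v w = Aligned v w × WellAligned (suc n) (δ v) (δ w)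

Critical : ℕ → List ℕ → ℕ → Set
Critical n v i =
  1 ≤ i × i ≤ n ∸ 1 ×
  (∃[ p ] ∃[ q ] ∃[ r ]
     (p < q × q < r × at v p ≡ i × suc i < at v q × at v r ≡ suc i))

-- Induction on n through δ. For i ≥ 2 the critical pattern i, j, i+1 of v survives in δ(v) as
-- i-1, j-1, i, and the order of i-1 and i in δ(w) is that of i and i+1 in w.
-- For i = 1, let v = … 1 … j … 2 … with 2 at position r. Alignment of (v,w) says v ascends
-- from v⁻¹(1) up to w⁻¹(1); as j > 2 precedes the 2, this run stops before r, so w⁻¹(1) < r.
-- Alignment of (δv,δw) gives r - 1 ≤ δ(v)⁻¹(1) ≤ δ(w)⁻¹(1), so w⁻¹(1) ≤ δ(w)⁻¹(1).
-- Were 2 before 1 in w, we would have δ(w)⁻¹(1) = w⁻¹(2) < w⁻¹(1).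
module Submission where

open import Defs
open import Data.Nat using (ℕ; zero; suc; _≤_; _<_; _≡ᵇ_; z≤n; s≤s; s≤s⁻¹)
open import Data.Nat.Properties
open import Data.Bool using (true; false)
open import Data.List using (List; []; _∷_; map; upTo; applyUpTo; length)
open import Data.List.Properties using (length-map; length-upTo)
open import Data.List.Relation.Unary.All.Properties using (All¬⇒¬Any)
open import Data.List.Relation.Unary.Any using (here; there)
open import Data.List.Membership.Propositional using (_∈_; _∉_)
open import Data.List.Relation.Unary.Unique.Propositional using (Unique; _∷_)
import Data.List.Relation.Unary.Unique.Propositional.Properties as Unique
open import Data.List.Relation.Binary.Permutation.Propositional
  using (_↭_; refl; prep; swap; ↭-sym; ↭⇒↭ₛ)
  renaming (trans to ↭-trans)
open import Data.List.Relation.Binary.Permutation.Propositional.Properties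
  using (∈-resp-↭; ↭-length)
import Data.List.Relation.Binary.Permutation.Setoid.Properties as ↭ₛ
open import Data.Product using (_,_; proj₁)
open import Data.Sum using (inj₁; inj₂)
open import Function using (_∘_)
open import Relation.Nullary using (contradiction)
open import Relation.Binary.PropositionalEquality
  using (_≡_; refl; sym; trans; cong; subst; setoid)

δ-resp-↭ : ∀ {xs ys} → xs ↭ ys → δ xs ↭ δ ys
δ-resp-↭ refl                                 = refl
δ-resp-↭ (prep zero p)                        = prep zero (δ-resp-↭ p)
δ-resp-↭ (prep (suc zero) p)                  = δ-resp-↭ p
δ-resp-↭ (prep (suc (suc x)) p)               = prep (suc x) (δ-resp-↭ p)
δ-resp-↭ (swap zero zero p)                   = swap _ _ (δ-resp-↭ p)
δ-resp-↭ (swap zero (suc zero) p)             = prep _ (δ-resp-↭ p)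
δ-resp-↭ (swap zero (suc (suc y)) p)          = swap _ _ (δ-resp-↭ p)
δ-resp-↭ (swap (suc zero) zero p)             = prep _ (δ-resp-↭ p)
δ-resp-↭ (swap (suc zero) (suc zero) p)       = δ-resp-↭ p
δ-resp-↭ (swap (suc zero) (suc (suc y)) p)    = prep _ (δ-resp-↭ p)
δ-resp-↭ (swap (suc (suc x)) zero p)          = swap _ _ (δ-resp-↭ p)
δ-resp-↭ (swap (suc (suc x)) (suc zero) p)    = prep _ (δ-resp-↭ p)
δ-resp-↭ (swap (suc (suc x)) (suc (suc y)) p) = swap _ _ (δ-resp-↭ p)
δ-resp-↭ (↭-trans p q)                        = ↭-trans (δ-resp-↭ p) (δ-resp-↭ q)

δ-map-suc-applyUpTo : ∀ (f : ℕ → ℕ) m →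
                      δ (map suc (applyUpTo (λ k → suc (f k)) m)) ≡ map suc (applyUpTo f m)
δ-map-suc-applyUpTo f zero    = refl
δ-map-suc-applyUpTo f (suc m) = cong (suc (f 0) ∷_) (δ-map-suc-applyUpTo (λ k → f (suc k)) m)

IsPerm-δ : ∀ {n v} → IsPerm (suc (suc n)) v → IsPerm (suc n) (δ v)
IsPerm-δ {n} {v} p = subst (δ v ↭_) (δ-map-suc-applyUpTo (λ k → k) (suc n)) (δ-resp-↭ p)

IsPerm⇒Unique : ∀ {n v} → IsPerm n v → Unique v
IsPerm⇒Unique {n} p =
  ↭ₛ.Unique-resp-↭ (setoid ℕ) (↭⇒↭ₛ (↭-sym p)) (Unique.map⁺ suc-injective (Unique.upTo⁺ n))

IsPerm⇒length : ∀ {n v} → IsPerm n v → length v ≡ n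
IsPerm⇒length {n} p = trans (↭-length p) (trans (length-map suc (upTo n)) (length-upTo n))

at-0 : ∀ l → at l 0 ≡ 0
at-0 []      = refl
at-0 (_ ∷ _) = refl

at⇒∈ : ∀ l k {y} → at l k ≡ suc y → suc y ∈ l
at⇒∈ []      k             ()
at⇒∈ (x ∷ l) zero          ()
at⇒∈ (x ∷ l) (suc zero)    e = here (sym e)
at⇒∈ (x ∷ l) (suc (suc k)) e = there (at⇒∈ l (suc k) e)

at⇒≤length : ∀ l k {y} → at l k ≡ suc y → k ≤ length l
at⇒≤length []      k             ()
at⇒≤length (x ∷ l) zero          ()
at⇒≤length (x ∷ l) (suc zero)    e = s≤s z≤n
at⇒≤length (x ∷ l) (suc (suc k)) e = s≤s (at⇒≤length l (suc k) e)

at⇒1≤ : ∀ l k {y} → at l k ≡ suc y → 1 ≤ k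
at⇒1≤ l zero    e = contradiction (subst (_≡ _) (at-0 l) e) λ ()
at⇒1≤ l (suc k) e = s≤s z≤n

≡ᵇ-refl : ∀ y → (y ≡ᵇ y) ≡ true
≡ᵇ-refl zero    = refl
≡ᵇ-refl (suc y) = ≡ᵇ-refl y

at⇒indexOf≤ : ∀ l k {y} → at l k ≡ suc y → indexOf (suc y) l ≤ k
at⇒indexOf≤ []      k             ()
at⇒indexOf≤ (x ∷ l) zero          ()
at⇒indexOf≤ (x ∷ l) (suc zero)    {y} refl rewrite ≡ᵇ-refl y = s≤s z≤n
at⇒indexOf≤ (x ∷ l) (suc (suc k)) {y} e with suc y ≡ᵇ x
... | true  = s≤s z≤n
... | false = s≤s (at⇒indexOf≤ l (suc k) e)

1≤indexOf-∷ : ∀ a y ys → 1 ≤ indexOf a (y ∷ ys)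
1≤indexOf-∷ a y ys with a ≡ᵇ y
... | true  = s≤s z≤n
... | false = s≤s z≤n

<-chain : ∀ (f : ℕ → ℕ) {q r} → q < r → (∀ k → q ≤ k → k < r → f k < f (suc k)) → f q < f r
<-chain f {q} {suc r} (s≤s q≤r) ascent with m≤n⇒m<n∨m≡n q≤r
... | inj₂ refl = ascent q ≤-refl ≤-refl
... | inj₁ q<r  = <-trans (<-chain f q<r λ k q≤k k<r → ascent k q≤k (m<n⇒m<1+n k<r))
                          (ascent r (<⇒≤ q<r) ≤-refl)

Critical⇒3≤n : ∀ {n v i} → IsPerm n v → Critical n v i → 3 ≤ n
Critical⇒3≤n {v = v} perm (s≤s _ , _ , p , q , r , p<q , q<r , vp≡i , _ , vr≡1+i) =
  ≤-trans (<-≤-trans (s≤s (<-≤-trans (s≤s (at⇒1≤ v p vp≡i)) p<q)) q<r)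
          (subst (r ≤_) (IsPerm⇒length perm) (at⇒≤length v r vr≡1+i))

-- δ-index v k is the 0-based position in δ v of the entry at 0-based position k of v.
δ-index : List ℕ → ℕ → ℕ
δ-index []                 k       = k
δ-index (x ∷ xs)           zero    = zero
δ-index (zero ∷ xs)        (suc k) = suc (δ-index xs k)
δ-index (suc zero ∷ xs)    (suc k) = δ-index xs k
δ-index (suc (suc x) ∷ xs) (suc k) = suc (δ-index xs k)

at-δ-index : ∀ v k {a} → at v (suc k) ≡ suc (suc a) → at (δ v) (suc (δ-index v k)) ≡ suc a
at-δ-index []                 k       ()
at-δ-index (x ∷ v)            zero    refl = refl
at-δ-index (zero ∷ v)         (suc k) e    = at-δ-index v k e
at-δ-index (suc zero ∷ v)     (suc k) e    = at-δ-index v k e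
at-δ-index (suc (suc x) ∷ v)  (suc k) e    = at-δ-index v k e

δ-index-mono : ∀ v k₁ k₂ {a b} → k₁ < k₂ →
               at v (suc k₁) ≡ suc (suc a) → at v (suc k₂) ≡ suc (suc b) →
               δ-index v k₁ < δ-index v k₂
δ-index-mono []                 k₁       k₂       lt () _
δ-index-mono (x ∷ v)            zero     (suc k₂) lt refl _ = s≤s z≤n
δ-index-mono (zero ∷ v)         (suc k₁) (suc k₂) lt e₁ e₂ = s≤s (δ-index-mono v k₁ k₂ (≤-pred lt) e₁ e₂)
δ-index-mono (suc zero ∷ v)     (suc k₁) (suc k₂) lt e₁ e₂ = δ-index-mono v k₁ k₂ (≤-pred lt) e₁ e₂
δ-index-mono (suc (suc x) ∷ v)  (suc k₁) (suc k₂) lt e₁ e₂ = s≤s (δ-index-mono v k₁ k₂ (≤-pred lt) e₁ e₂)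

Critical-δ : ∀ {n v i} → Critical (suc (suc n)) v (suc (suc i)) → Critical (suc n) (δ v) (suc i)
Critical-δ {v = v} (_ , _ , zero , q , r , _ , _ , vp≡2+i , _) =
  contradiction (subst (_≡ _) (at-0 v) vp≡2+i) λ ()
Critical-δ {v = v} (_ , s≤s i≤n , suc p , suc q , suc r , p<q , q<r , vp≡2+i , 3+i<vq , vr≡3+i)
  with at v (suc q) in vq
... | zero        = contradiction 3+i<vq λ ()
... | suc zero    = contradiction 3+i<vq λ { (s≤s ()) }
... | suc (suc j) =
  s≤s z≤n , i≤n ,
  suc (δ-index v p) , suc (δ-index v q) , suc (δ-index v r) ,
  s≤s (δ-index-mono v p q (≤-pred p<q) vp≡2+i vq) ,
  s≤s (δ-index-mono v q r (≤-pred q<r) vq vr≡3+i) ,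
  at-δ-index v p vp≡2+i ,
  subst (suc (suc _) ≤_) (sym (at-δ-index v q vq)) (≤-pred 3+i<vq) ,
  at-δ-index v r vr≡3+i

1≤indexOf-δ⇒1≤indexOf : ∀ w a b → 1 ≤ indexOf a (δ w) → 1 ≤ indexOf b w
1≤indexOf-δ⇒1≤indexOf []      a b ()
1≤indexOf-δ⇒1≤indexOf (y ∷ ys) a b _ = 1≤indexOf-∷ b y ys

indexOf-δ-<⇒indexOf-< : ∀ w x y → indexOf (suc x) (δ w) < indexOf (suc y) (δ w) →
                        indexOf (suc (suc x)) w < indexOf (suc (suc y)) w
indexOf-δ-<⇒indexOf-< []                x y ()
indexOf-δ-<⇒indexOf-< (zero ∷ w)        x y lt = s≤s (indexOf-δ-<⇒indexOf-< w x y (≤-pred lt))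
indexOf-δ-<⇒indexOf-< (suc zero ∷ w)    x y lt = s≤s (indexOf-δ-<⇒indexOf-< w x y lt)
indexOf-δ-<⇒indexOf-< (suc (suc z) ∷ w) x y lt with x ≡ᵇ z | y ≡ᵇ z
... | true  | true  = contradiction lt (<-irrefl refl)
... | true  | false = s≤s (1≤indexOf-δ⇒1≤indexOf w (suc y) (suc (suc y)) (≤-pred lt))
... | false | true  = contradiction lt λ { (s≤s ()) }
... | false | false = s≤s (indexOf-δ-<⇒indexOf-< w x y (≤-pred lt))

at≡2⇒≤indexOf1-δ : ∀ v r → Unique v → 1 ∉ v → at v r ≡ 2 → r ≤ indexOf 1 (δ v)
at≡2⇒≤indexOf1-δ []                        r             _       _  ()
at≡2⇒≤indexOf1-δ (x ∷ v)                   zero          _       _  ()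
at≡2⇒≤indexOf1-δ (x ∷ v)                   (suc zero)    _       _  refl = s≤s z≤n
at≡2⇒≤indexOf1-δ (zero ∷ v)                (suc (suc k)) (_ ∷ u) 1∉ e =
  s≤s (at≡2⇒≤indexOf1-δ v (suc k) u (1∉ ∘ there) e)
at≡2⇒≤indexOf1-δ (suc zero ∷ v)            (suc (suc k)) _       1∉ e = contradiction (here refl) 1∉
at≡2⇒≤indexOf1-δ (suc (suc zero) ∷ v)      (suc (suc k)) (2∉ ∷ _) 1∉ e = contradiction (at⇒∈ v (suc k) e) (All¬⇒¬Any 2∉)
at≡2⇒≤indexOf1-δ (suc (suc (suc z)) ∷ v)   (suc (suc k)) (_ ∷ u) 1∉ e =
  s≤s (at≡2⇒≤indexOf1-δ v (suc k) u (1∉ ∘ there) e)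

at≡2⇒≤1+indexOf1-δ : ∀ v r → Unique v → at v r ≡ 2 → r ≤ suc (indexOf 1 (δ v))
at≡2⇒≤1+indexOf1-δ []                      r             _        ()
at≡2⇒≤1+indexOf1-δ (x ∷ v)                 zero          _        ()
at≡2⇒≤1+indexOf1-δ (x ∷ v)                 (suc zero)    _        refl = s≤s z≤n
at≡2⇒≤1+indexOf1-δ (zero ∷ v)              (suc (suc k)) (_ ∷ u)  e = s≤s (at≡2⇒≤1+indexOf1-δ v (suc k) u e)
at≡2⇒≤1+indexOf1-δ (suc zero ∷ v)          (suc (suc k)) (1∉ ∷ u) e = s≤s (at≡2⇒≤indexOf1-δ v (suc k) u (All¬⇒¬Any 1∉) e)
at≡2⇒≤1+indexOf1-δ (suc (suc zero) ∷ v)    (suc (suc k)) (2∉ ∷ _) e = contradiction (at⇒∈ v (suc k) e) (All¬⇒¬Any 2∉)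
at≡2⇒≤1+indexOf1-δ (suc (suc (suc z)) ∷ v) (suc (suc k)) (_ ∷ u)  e = s≤s (at≡2⇒≤1+indexOf1-δ v (suc k) u e)

indexOf1≤indexOf1-δ⇒1-before-2 : ∀ w → 1 ∈ w → 2 ∈ w → indexOf 1 w ≤ indexOf 1 (δ w) → indexOf 1 w < indexOf 2 w
indexOf1≤indexOf1-δ⇒1-before-2 []                        ()         _          _
indexOf1≤indexOf1-δ⇒1-before-2 (zero ∷ w)                (here ())  _          _
indexOf1≤indexOf1-δ⇒1-before-2 (zero ∷ w)                (there _)  (here ())  _
indexOf1≤indexOf1-δ⇒1-before-2 (zero ∷ w)                (there 1∈) (there 2∈) h =
  s≤s (indexOf1≤indexOf1-δ⇒1-before-2 w 1∈ 2∈ (≤-pred h))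
indexOf1≤indexOf1-δ⇒1-before-2 (suc zero ∷ w)            _          (here ())  _
indexOf1≤indexOf1-δ⇒1-before-2 (suc zero ∷ [])           _          (there ()) _
indexOf1≤indexOf1-δ⇒1-before-2 (suc zero ∷ y ∷ ys)       _          (there _)  _ = s≤s (1≤indexOf-∷ 2 y ys)
indexOf1≤indexOf1-δ⇒1-before-2 (suc (suc zero) ∷ w)      (here ())  _          _
indexOf1≤indexOf1-δ⇒1-before-2 (suc (suc zero) ∷ [])     (there ()) _          _
indexOf1≤indexOf1-δ⇒1-before-2 (suc (suc zero) ∷ y ∷ ys) (there _)  _          h =
  contradiction (≤-trans (s≤s (1≤indexOf-∷ 1 y ys)) h) 1+n≰n
indexOf1≤indexOf1-δ⇒1-before-2 (suc (suc (suc z)) ∷ w)   (here ())  _          _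
indexOf1≤indexOf1-δ⇒1-before-2 (suc (suc (suc z)) ∷ w)   (there _)  (here ())  _
indexOf1≤indexOf1-δ⇒1-before-2 (suc (suc (suc z)) ∷ w)   (there 1∈) (there 2∈) h =
  s≤s (indexOf1≤indexOf1-δ⇒1-before-2 w 1∈ 2∈ (≤-pred h))

Critical-1 : ∀ {n v w} → Aligned v w → indexOf 1 (δ v) ≤ indexOf 1 (δ w) →
             Unique v → 1 ∈ w → 2 ∈ w → Critical n v 1 → indexOf 1 w < indexOf 2 w
Critical-1 {v = v} {w} (_ , ascent) δv≤δw uv 1∈w 2∈w
           (_ , _ , p , q , r , p<q , q<r , vp≡1 , 2<vq , vr≡2) =
  indexOf1≤indexOf1-δ⇒1-before-2 w 1∈w 2∈w (s≤s⁻¹ (begin-strict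
    indexOf 1 w           <⟨ w⁻¹1<r ⟩
    r                     ≤⟨ at≡2⇒≤1+indexOf1-δ v r uv vr≡2 ⟩
    suc (indexOf 1 (δ v)) ≤⟨ s≤s δv≤δw ⟩
    suc (indexOf 1 (δ w)) ∎))
  where
  open ≤-Reasoning
  w⁻¹1<r : indexOf 1 w < r
  w⁻¹1<r = ≰⇒> λ r≤w⁻¹1 → <-asym 2<vq (subst (at v q <_) vr≡2
    (<-chain (at v) q<r λ k q≤k k<r →
       ascent k (≤-trans (at⇒indexOf≤ v p vp≡1) (≤-trans (<⇒≤ p<q) q≤k))
                (∸-monoˡ-≤ 1 (<-≤-trans k<r r≤w⁻¹1))))

lemma3p7 : (n : ℕ) (v w : List ℕ) → IsPerm n v → IsPerm n w →
           WellAligned n v w →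
           (i : ℕ) → Critical n v i →
           indexOf i w < indexOf (suc i) w
lemma3p7 n v w _ _ _ zero (() , _)
lemma3p7 (suc (suc (suc n))) v w pv pw (aligned , δ-aligned , _) (suc zero) crit =
  Critical-1 {suc (suc (suc n))} aligned (proj₁ δ-aligned) (IsPerm⇒Unique pv)
             (∈-resp-↭ (↭-sym pw) (here refl)) (∈-resp-↭ (↭-sym pw) (there (here refl))) crit
lemma3p7 (suc (suc n)) v w pv pw (_ , δ-wellAligned) (suc (suc i)) crit =
  indexOf-δ-<⇒indexOf-< w i (suc i)
    (lemma3p7 (suc n) (δ v) (δ w) (IsPerm-δ pv) (IsPerm-δ pw) δ-wellAligned (suc i) (Critical-δ {n} {v} crit))
lemma3p7 (suc (suc zero)) v w pv _ _ (suc zero) crit = contradiction (Critical⇒3≤n pv crit) λ { (s≤s (s≤s ())) }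
lemma3p7 (suc zero) v w _ _ _ (suc i) (_ , () , _)
lemma3p7 zero       v w _ _ _ (suc i) (_ , () , _)
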